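{- Let $\tau=\tau^0\mbox{ - }\tau^1\mbox{ - }\cdots\mbox{ - }\tau^s$ be a multi-pattern and let $\phi=f_0(\tau^0)\mbox{ - }f_1(\tau^1)\mbox{ - }\cdots\mbox{ - }f_s(\tau^s)$, where each $f_i$ is an arbitrary trivial bijection. Then $\tau\equiv\phi$.
   Context: $[k]^n$ = words of length $n$ over $\{1,\dots,k\}$. A generalized pattern with no hyphens is a word over $[m]$ using every letter of $[m]$. A multi-pattern $\tau^0\mbox{ - }\tau^1\mbox{ - }\cdots\mbox{ - }\tau^s$ (each $\tau^i$ a generalized pattern with no hyphens) is the pattern obtained by concatenating the $\tau^i$ with hyphens between consecutive blocks, where every letter of $\tau^i$ is incomparable with every letter of $\tau^j$ for $i\ne j$. A word $\sigma$ contains it if $\sigma$ has occurrences (as factors of consecutive letters, order-isomorphic to the block, with equalities preserved) of $\tau^0,\dots,\tau^s$ in this left-to-right order, pairwise non-overlapping; otherwise $\sigma$ avoids it. Two patterns are equivalent ($\equiv$) if for every $k$ and $n$ the numbers of words in $[k]^n$ avoiding them are equal. Trivial bijections are the reverse $R(\sigma_1\cdots\sigma_n)=\sigma_n\cdots\sigma_1$, the complement $C$ (replacing each letter $a$ by $M+1-a$, $M$ the largest letter of the pattern), and $R\circ C$. -}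

module Defs where

open import Data.Nat using (ℕ; zero; suc; _+_; _∸_; _⊔_; _≤_; _<ᵇ_; _≡ᵇ_)
open import Data.Bool using (Bool; true; false; _∧_; _∨_; not)
open import Data.List using (List; []; _∷_; map; concatMap; reverse; length; take; drop; zip; upTo; foldr; filterᵇ)
open import Data.List.Membership.Propositional using (_∈_)
open import Data.Product using (_×_; _,_)
open import Relation.Binary.PropositionalEquality using (_≡_)

-- Words are lists of natural numbers; a word in [k]^n has letters in {1,…,k}.

maxLetter : List ℕ → ℕ
maxLetter = foldr _⊔_ 0

IsGenPattern : List ℕ → Set
IsGenPattern p =
  ((a : ℕ) → a ∈ p → (1 ≤ a × a ≤ maxLetter p)) ×
  ((a : ℕ) → 1 ≤ a → a ≤ maxLetter p → a ∈ p)

data TrivBij : Set where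
  R C RC : TrivBij

complement : List ℕ → List ℕ
complement p = map (λ a → suc (maxLetter p) ∸ a) p

applyTB : TrivBij → List ℕ → List ℕ
applyTB R  p = reverse p
applyTB C  p = complement p
applyTB RC p = reverse (complement p)

-- Order-isomorphism (equalities preserved) of two words of equal length:
-- for all positions i, j:  y_i < y_j ⇔ p_i < p_j  and  y_i = y_j ⇔ p_i = p_j.
sameCmp : ℕ × ℕ → ℕ × ℕ → Bool
sameCmp (y₁ , p₁) (y₂ , p₂) =
  (not ((y₁ <ᵇ y₂) ∧ not (p₁ <ᵇ p₂)) ∧ not ((p₁ <ᵇ p₂) ∧ not (y₁ <ᵇ y₂))) ∧
  (not ((y₁ ≡ᵇ y₂) ∧ not (p₁ ≡ᵇ p₂)) ∧ not ((p₁ ≡ᵇ p₂) ∧ not (y₁ ≡ᵇ y₂)))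

allB : {A : Set} → (A → Bool) → List A → Bool
allB f = foldr (λ a b → f a ∧ b) true

isoB : List ℕ → List ℕ → Bool
isoB y p = (length y ≡ᵇ length p) ∧ allB (λ a → allB (sameCmp a) zs) zs
  where zs = zip y p

-- containsB [τ⁰, …, τˢ] w : the word w contains the multi-pattern
-- τ⁰-τ¹-…-τˢ, i.e. has occurrences (as factors) of τ⁰,…,τˢ in this
-- left-to-right order, pairwise non-overlapping.
-- occursThen p ps w : some factor of w order-isomorphic to p is followed
-- (strictly to its right, no overlap) by an occurrence of the multi-pattern ps.
mutual
  containsB : List (List ℕ) → List ℕ → Bool
  containsB []       w = true
  containsB (p ∷ ps) w = occursThen p ps w

  occursThen : List ℕ → List (List ℕ) → List ℕ → Bool
  occursThen p ps [] = isoB [] p ∧ containsB ps []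
  occursThen p ps (x ∷ w) =
    (isoB (take (length p) (x ∷ w)) p ∧ containsB ps (drop (length p) (x ∷ w)))
    ∨ occursThen p ps w

letters : ℕ → List ℕ
letters k = map suc (upTo k)

allWords : ℕ → ℕ → List (List ℕ)
allWords k zero    = [] ∷ []
allWords k (suc n) = concatMap (λ a → map (a ∷_) (allWords k n)) (letters k)

avoidCount : List (List ℕ) → ℕ → ℕ → ℕ
avoidCount τ k n = length (filterᵇ (λ w → not (containsB τ w)) (allWords k n))

_≡ₚ_ : List (List ℕ) → List (List ℕ) → Set
τ ≡ₚ φ = (k n : ℕ) → avoidCount τ k n ≡ avoidCount φ k n

-- Whether a word w contains τ⁰-τ¹-…-τˢ is decided at the shortest prefix of w containing τ⁰:
-- w contains the multi-pattern iff that prefix exists and the rest of w contains τ¹-…-τˢ.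
-- Counting the words of [k]^n by the length m + 1 of that prefix only needs the number
-- a(m+1) − k·a(m) of words of [k]^(m+1) containing τ⁰ whose prefix of length m does not, where
-- a(j) is the number of words of [k]^j containing τ⁰. Hence the number of words of [k]^n
-- containing a multi-pattern depends only on the corresponding numbers for its blocks, and a
-- trivial bijection f preserves those: reversing, resp. complementing (a ↦ k + 1 − a), the words
-- of [k]^j is a bijection taking the words containing τⁱ to those containing f(τⁱ).
module Submission where

open import Defs
open import Data.Nat using (ℕ; zero; suc; _+_; _*_; _∸_; _≤_; _<ᵇ_; _≡ᵇ_; z≤n; s≤s)
open import Data.Fin using (Fin; toℕ; opposite)
open import Data.List using (List; []; _∷_; [_]; _++_; length; map; reverse; take; drop; zip; filterᵇ; concatMap; applyUpTo)
open import Data.Vec.Functional using (toList)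
open import Data.Bool using (Bool; true; false; T; not; _∧_; _∨_; if_then_else_)
open import Data.Bool.Properties using (T-∧; T-∨; ∧-identityʳ; ∧-comm; ∧-assoc; ∨-inverseˡ)
open import Data.Empty using (⊥-elim)
open import Data.Fin.Properties using (toℕ<n; opposite-prop)
import Data.Fin.Permutation as Perm
open import Data.List.Properties
  using (length-++; length-map; length-reverse; length-++-≤ˡ; ++-assoc; ++-identityʳ; filter-++; take++drop≡id;
         take-take; drop-drop; take-map; zip-map; map-∘; map-id-local; unfold-reverse; reverse-++; reverse-involutive)
open import Data.List.Relation.Unary.All as All using (All; []; _∷_)
open import Data.List.Relation.Unary.All.Properties using (take⁺; map⁺)
open import Data.List.Relation.Binary.Pointwise using (Pointwise; []; _∷_; tabulate⁺)
open import Data.Nat.Properties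
  using (+-*-semiring; suc-injective; +-identityʳ; +-comm; +-suc; +-cancelʳ-≡; +-∸-assoc; ≤-refl; ≤-trans; m≤m⊔n; m≤n⊔m; n≤1+n;
         m≤n⇒m≤1+n; m≤n⇒m⊓n≡m; m≤n⇒m<n∨m≡n; m∸n≤m; m∸[m∸n]≡n; ∸-monoʳ-<; ∸-cancelʳ-<; ∸-cancelˡ-≡;
         <ᵇ⇒<; <⇒<ᵇ; ≡ᵇ⇒≡; ≡⇒≡ᵇ)
open import Data.Product using (_×_; _,_; proj₁; proj₂; ∃-syntax)
import Data.Product as Product
open import Data.Sum using (inj₁; inj₂)
open import Function using (_∘_; Equivalence)
open import Relation.Binary.PropositionalEquality using (_≡_; _≗_; refl; sym; trans; cong; cong₂; subst; module ≡-Reasoning)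
open import Relation.Nullary using (¬_; yes; no)
open import Relation.Nullary.Decidable using (T?)
open import Relation.Nullary.Reflects using (det; fromEquivalence; T-reflects)
open import Algebra.Properties.Semiring.Sum +-*-semiring
  using (sum-syntax; sum-cong-≗; sum-replicate-zero; ∑-distrib-+; ∑-comm; sum-permute; *-distribʳ-sum)

open Equivalence using (to; from)
open ≡-Reasoning

bool-ext : ∀ {x y} → (T x → T y) → (T y → T x) → x ≡ y
bool-ext {x} {y} x⇒y y⇒x = det (fromEquivalence {b = x} x⇒y y⇒x) (T-reflects y)

T-not⇒¬T : ∀ {x} → T (not x) → ¬ T x
T-not⇒¬T {false} _ ()

¬T⇒T-not : ∀ {x} → ¬ T x → T (not x)
¬T⇒T-not {true}  ¬x = ¬x _
¬T⇒T-not {false} _  = _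

split-by-implied : ∀ x y → (T y → T x) → x ≡ (x ∧ not y) ∨ y
split-by-implied true  true  _   = refl
split-by-implied true  false _   = refl
split-by-implied false true  y⇒x = ⊥-elim (y⇒x _)
split-by-implied false false _   = refl

indicator : Bool → ℕ
indicator b = if b then 1 else 0

indicator-∨ : ∀ {x y} → (T x → ¬ T y) → indicator (x ∨ y) ≡ indicator x + indicator y
indicator-∨ {true}  {true}  disj = ⊥-elim (disj _ _)
indicator-∨ {true}  {false} _    = refl
indicator-∨ {false}         _    = refl

-- Counting words of [k]^n

module _ (k : ℕ) where

  letter : Fin k → ℕ
  letter i = suc (toℕ i)

  count : ℕ → (List ℕ → Bool) → ℕ
  count zero    P = indicator (P [])
  count (suc n) P = ∑[ i < k ] count n (λ w → P (letter i ∷ w))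

  count-congʷ : ∀ n {P Q} → (∀ w → length w ≡ n → All (_≤ k) w → P w ≡ Q w) → count n P ≡ count n Q
  count-congʷ zero    P≡Q = cong indicator (P≡Q [] refl [])
  count-congʷ (suc n) P≡Q = sum-cong-≗ {k} λ i →
    count-congʷ n λ w |w|≡n w≤k → P≡Q (letter i ∷ w) (cong suc |w|≡n) (toℕ<n i ∷ w≤k)

  count-cong : ∀ n {P Q} → P ≗ Q → count n P ≡ count n Q
  count-cong n P≗Q = count-congʷ n λ w _ _ → P≗Q w

  count-false : ∀ n → count n (λ _ → false) ≡ 0
  count-false zero    = refl
  count-false (suc n) = trans (sum-cong-≗ {k} λ _ → count-false n) (sum-replicate-zero k)

  count-∨ : ∀ n {P Q} → (∀ w → T (P w) → ¬ T (Q w)) → count n (λ w → P w ∨ Q w) ≡ count n P + count n Q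
  count-∨ zero    disj = indicator-∨ (disj [])
  count-∨ (suc n) disj = trans (sum-cong-≗ {k} λ i → count-∨ n (disj ∘ (letter i ∷_))) (∑-distrib-+ {k} _ _)

  count-∧-split : ∀ m n P Q → count (m + n) (λ w → P (take m w) ∧ Q (drop m w)) ≡ count m P * count n Q
  count-∧-split zero    n P Q with P []
  ... | true  = sym (+-identityʳ _)
  ... | false = count-false n
  count-∧-split (suc m) n P Q =
    trans (sum-cong-≗ {k} λ i → count-∧-split m n (P ∘ (letter i ∷_)) Q) (sym (*-distribʳ-sum {k} _ _))

  count-not : ∀ n P → count n (not ∘ P) + count n P ≡ count n (λ _ → true)
  count-not n P = trans (sym (count-∨ n λ w → T-not⇒¬T)) (count-cong n (∨-inverseˡ ∘ P))

  count-not-cong : ∀ n {P Q} → count n P ≡ count n Q → count n (not ∘ P) ≡ count n (not ∘ Q)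
  count-not-cong n {P} {Q} P≡Q = +-cancelʳ-≡ (count n P) _ _ (begin
    count n (not ∘ P) + count n P  ≡⟨ count-not n P ⟩
    count n (λ _ → true)           ≡⟨ count-not n Q ⟨
    count n (not ∘ Q) + count n Q  ≡⟨ cong (count n (not ∘ Q) +_) P≡Q ⟨
    count n (not ∘ Q) + count n P  ∎)

  count-snoc : ∀ n P → count (suc n) P ≡ ∑[ i < k ] count n (λ w → P (w ++ [ letter i ]))
  count-snoc zero    P = refl
  count-snoc (suc n) P = trans (sum-cong-≗ {k} λ j → count-snoc n (P ∘ (letter j ∷_))) (∑-comm {k} {k} _)

  count-reverse : ∀ n P → count n (P ∘ reverse) ≡ count n P
  count-reverse zero    P = refl
  count-reverse (suc n) P = begin
    ∑[ i < k ] count n (λ w → P (reverse (letter i ∷ w)))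
      ≡⟨ sum-cong-≗ {k} (λ i → count-cong n λ w → cong P (unfold-reverse (letter i) w)) ⟩
    ∑[ i < k ] count n (λ w → P (reverse w ++ [ letter i ]))
      ≡⟨ sum-cong-≗ {k} (λ i → count-reverse n λ w → P (w ++ [ letter i ])) ⟩
    ∑[ i < k ] count n (λ w → P (w ++ [ letter i ]))
      ≡⟨ count-snoc n P ⟨
    count (suc n) P ∎

  complement-letter : ∀ i → suc k ∸ letter i ≡ letter (opposite i)
  complement-letter i = trans (+-∸-assoc 1 (toℕ<n i)) (cong suc (sym (opposite-prop i)))

  count-complement : ∀ n P → count n (P ∘ map (suc k ∸_)) ≡ count n P
  count-complement zero    P = refl
  count-complement (suc n) P = begin
    ∑[ i < k ] count n (λ w → P (suc k ∸ letter i ∷ map (suc k ∸_) w))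
      ≡⟨ sum-cong-≗ {k} (λ i → count-complement n λ w → P (suc k ∸ letter i ∷ w)) ⟩
    ∑[ i < k ] count n (λ w → P (suc k ∸ letter i ∷ w))
      ≡⟨ sum-cong-≗ {k} (λ i → cong (λ a → count n λ w → P (a ∷ w)) (complement-letter i)) ⟩
    ∑[ i < k ] count n (λ w → P (letter (opposite i) ∷ w))
      ≡⟨ sum-permute {k} _ Perm.reverse ⟨
    count (suc n) P ∎

length-filterᵇ-++ : ∀ (P : List ℕ → Bool) xs ys →
                    length (filterᵇ P (xs ++ ys)) ≡ length (filterᵇ P xs) + length (filterᵇ P ys)
length-filterᵇ-++ P xs ys = trans (cong length (filter-++ (T? ∘ P) xs ys)) (length-++ (filterᵇ P xs))

length-filterᵇ-map : ∀ {A : Set} (P : List ℕ → Bool) (f : A → List ℕ) xs → length (filterᵇ P (map f xs)) ≡ length (filterᵇ (P ∘ f) xs)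
length-filterᵇ-map P f []       = refl
length-filterᵇ-map P f (x ∷ xs) with P (f x)
... | true  = cong suc (length-filterᵇ-map P f xs)
... | false = length-filterᵇ-map P f xs

length-filterᵇ-extensions : ∀ (P : List ℕ → Bool) X (f : ℕ → ℕ) m →
  length (filterᵇ P (concatMap (λ a → map (a ∷_) X) (map suc (applyUpTo f m))))
    ≡ ∑[ i < m ] length (filterᵇ (λ w → P (suc (f (toℕ i)) ∷ w)) X)
length-filterᵇ-extensions P X f zero    = refl
length-filterᵇ-extensions P X f (suc m) =
  trans (length-filterᵇ-++ P (map (suc (f 0) ∷_) X) _)
        (cong₂ _+_ (length-filterᵇ-map P (suc (f 0) ∷_) X) (length-filterᵇ-extensions P X (f ∘ suc) m))

length-filterᵇ-allWords : ∀ k n P → length (filterᵇ P (allWords k n)) ≡ count k n P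
length-filterᵇ-allWords k zero P with P []
... | true  = refl
... | false = refl
length-filterᵇ-allWords k (suc n) P =
  trans (length-filterᵇ-extensions P (allWords k n) (λ a → a) k)
        (sum-cong-≗ {k} λ i → length-filterᵇ-allWords k n _)

-- Order-isomorphism under reversal and complementation

data Comparisonᵇ : Bool → Bool → Bool → Set where
  less    : Comparisonᵇ true  false false
  equal   : Comparisonᵇ false false true
  greater : Comparisonᵇ false true  false

compareᵇ : ∀ m n → Comparisonᵇ (m <ᵇ n) (n <ᵇ m) (m ≡ᵇ n)
compareᵇ zero    zero    = equal
compareᵇ zero    (suc n) = less
compareᵇ (suc m) zero    = greater
compareᵇ (suc m) (suc n) = compareᵇ m n

∸-<ᵇ : ∀ {N a b} → a ≤ N → (N ∸ a <ᵇ N ∸ b) ≡ (b <ᵇ a)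
∸-<ᵇ {N} {a} {b} a≤N = bool-ext
  (λ h → <⇒<ᵇ (∸-cancelʳ-< {a} {b} {N} (<ᵇ⇒< (N ∸ a) (N ∸ b) h)))
  (λ h → <⇒<ᵇ (∸-monoʳ-< (<ᵇ⇒< b a h) a≤N))

∸-≡ᵇ : ∀ {N a b} → a ≤ N → b ≤ N → (N ∸ a ≡ᵇ N ∸ b) ≡ (a ≡ᵇ b)
∸-≡ᵇ {N} {a} {b} a≤N b≤N = bool-ext
  (λ h → ≡⇒≡ᵇ a b (∸-cancelˡ-≡ a≤N b≤N (≡ᵇ⇒≡ (N ∸ a) (N ∸ b) h)))
  (λ h → ≡⇒≡ᵇ (N ∸ a) (N ∸ b) (cong (N ∸_) (≡ᵇ⇒≡ a b h)))

-- Reversing both orders turns < into > on both sides, which sameCmp cannot tell apart.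
sameCmp-∸ : ∀ {N M y₁ y₂ q₁ q₂} → y₁ ≤ N → y₂ ≤ N → q₁ ≤ M → q₂ ≤ M →
            sameCmp (N ∸ y₁ , M ∸ q₁) (N ∸ y₂ , M ∸ q₂) ≡ sameCmp (y₁ , q₁) (y₂ , q₂)
sameCmp-∸ {y₁ = y₁} {y₂} {q₁} {q₂} y₁≤N y₂≤N q₁≤M q₂≤M
  rewrite ∸-<ᵇ {b = y₂} y₁≤N | ∸-<ᵇ {b = q₂} q₁≤M | ∸-≡ᵇ y₁≤N y₂≤N | ∸-≡ᵇ q₁≤M q₂≤M
  with y₁ <ᵇ y₂ | y₂ <ᵇ y₁ | y₁ ≡ᵇ y₂ | compareᵇ y₁ y₂ | q₁ <ᵇ q₂ | q₂ <ᵇ q₁ | q₁ ≡ᵇ q₂ | compareᵇ q₁ q₂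
... | _ | _ | _ | less    | _ | _ | _ | less    = refl
... | _ | _ | _ | less    | _ | _ | _ | equal   = refl
... | _ | _ | _ | less    | _ | _ | _ | greater = refl
... | _ | _ | _ | equal   | _ | _ | _ | less    = refl
... | _ | _ | _ | equal   | _ | _ | _ | equal   = refl
... | _ | _ | _ | equal   | _ | _ | _ | greater = refl
... | _ | _ | _ | greater | _ | _ | _ | less    = refl
... | _ | _ | _ | greater | _ | _ | _ | equal   = refl
... | _ | _ | _ | greater | _ | _ | _ | greater = refl

allB-cong : ∀ {A : Set} {f g : A → Bool} → f ≗ g → allB f ≗ allB g
allB-cong f≗g []      = refl
allB-cong f≗g (a ∷ l) = cong₂ _∧_ (f≗g a) (allB-cong f≗g l)

allB-congᴬ : ∀ {A : Set} {Q : A → Set} {f g : A → Bool} {l} → All Q l → (∀ {a} → Q a → f a ≡ g a) → allB f l ≡ allB g l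
allB-congᴬ []         f≡g = refl
allB-congᴬ (qa ∷ ql) f≡g = cong₂ _∧_ (f≡g qa) (allB-congᴬ ql f≡g)

allB-map : ∀ {A B : Set} (f : B → Bool) (g : A → B) l → allB f (map g l) ≡ allB (f ∘ g) l
allB-map f g []      = refl
allB-map f g (a ∷ l) = cong (f (g a) ∧_) (allB-map f g l)

allB-++ : ∀ {A : Set} (f : A → Bool) xs ys → allB f (xs ++ ys) ≡ allB f xs ∧ allB f ys
allB-++ f []       ys = refl
allB-++ f (x ∷ xs) ys = trans (cong (f x ∧_) (allB-++ f xs ys)) (sym (∧-assoc (f x) _ _))

allB-reverse : ∀ {A : Set} (f : A → Bool) xs → allB f (reverse xs) ≡ allB f xs
allB-reverse f []       = refl
allB-reverse f (x ∷ xs) = begin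
  allB f (reverse (x ∷ xs))           ≡⟨ cong (allB f) (unfold-reverse x xs) ⟩
  allB f (reverse xs ++ [ x ])        ≡⟨ allB-++ f (reverse xs) [ x ] ⟩
  allB f (reverse xs) ∧ (f x ∧ true)  ≡⟨ cong₂ _∧_ (allB-reverse f xs) (∧-identityʳ (f x)) ⟩
  allB f xs ∧ f x                     ≡⟨ ∧-comm (allB f xs) (f x) ⟩
  f x ∧ allB f xs                     ∎

zip-++ : ∀ {A B : Set} (xs xs′ : List A) (ys ys′ : List B) → length xs ≡ length ys →
         zip (xs ++ xs′) (ys ++ ys′) ≡ zip xs ys ++ zip xs′ ys′
zip-++ []       xs′ []       ys′ _     = refl
zip-++ (x ∷ xs) xs′ (y ∷ ys) ys′ |xs|≡|ys| = cong ((x , y) ∷_) (zip-++ xs xs′ ys ys′ (suc-injective |xs|≡|ys|))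

zip-reverse : ∀ {A B : Set} (xs : List A) (ys : List B) → length xs ≡ length ys →
              zip (reverse xs) (reverse ys) ≡ reverse (zip xs ys)
zip-reverse []       []       _ = refl
zip-reverse (x ∷ xs) (y ∷ ys) |xs|≡|ys| = begin
  zip (reverse (x ∷ xs)) (reverse (y ∷ ys))
    ≡⟨ cong₂ zip (unfold-reverse x xs) (unfold-reverse y ys) ⟩
  zip (reverse xs ++ [ x ]) (reverse ys ++ [ y ])
    ≡⟨ zip-++ (reverse xs) _ (reverse ys) _ (trans (length-reverse xs) (trans |xs|≡|ys|′ (sym (length-reverse ys)))) ⟩
  zip (reverse xs) (reverse ys) ++ [ (x , y) ]
    ≡⟨ cong (_++ [ (x , y) ]) (zip-reverse xs ys |xs|≡|ys|′) ⟩
  reverse (zip xs ys) ++ [ (x , y) ]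
    ≡⟨ unfold-reverse (x , y) (zip xs ys) ⟨
  reverse (zip (x ∷ xs) (y ∷ ys)) ∎
  where |xs|≡|ys|′ = suc-injective |xs|≡|ys|

zip-All : ∀ {A B : Set} {P : A → Set} {Q : B → Set} {xs ys} → All P xs → All Q ys →
          All (λ z → P (proj₁ z) × Q (proj₂ z)) (zip xs ys)
zip-All []         _          = []
zip-All (_ ∷ _)    []         = []
zip-All (px ∷ pxs) (qy ∷ qys) = (px , qy) ∷ zip-All pxs qys

sameCmpAll : List (ℕ × ℕ) → Bool
sameCmpAll zs = allB (λ a → allB (sameCmp a) zs) zs

sameCmpAll-reverse : ∀ zs → sameCmpAll (reverse zs) ≡ sameCmpAll zs
sameCmpAll-reverse zs = trans (allB-cong (λ a → allB-reverse (sameCmp a) zs) (reverse zs)) (allB-reverse _ zs)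

sameCmpAll-map : ∀ {Q : ℕ × ℕ → Set} h {zs} → All Q zs →
                 (∀ {a c} → Q a → Q c → sameCmp (h a) (h c) ≡ sameCmp a c) → sameCmpAll (map h zs) ≡ sameCmpAll zs
sameCmpAll-map h {zs} qs h-pres = begin
  allB (λ a → allB (sameCmp a) (map h zs)) (map h zs)  ≡⟨ allB-map _ h zs ⟩
  allB (λ a → allB (sameCmp (h a)) (map h zs)) zs      ≡⟨ allB-congᴬ qs (λ {a} _ → allB-map (sameCmp (h a)) h zs) ⟩
  allB (λ a → allB (sameCmp (h a) ∘ h) zs) zs          ≡⟨ allB-congᴬ qs (λ qa → allB-congᴬ qs (h-pres qa)) ⟩
  sameCmpAll zs                                        ∎

isoB-reverse : ∀ y q → isoB (reverse y) (reverse q) ≡ isoB y q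
isoB-reverse y q rewrite length-reverse y | length-reverse q with length y ≡ᵇ length q in |y|≡ᵇ|q|
... | false = refl
... | true  = trans (cong sameCmpAll (zip-reverse y q |y|≡|q|)) (sameCmpAll-reverse (zip y q))
  where |y|≡|q| = ≡ᵇ⇒≡ (length y) (length q) (subst T (sym |y|≡ᵇ|q|) _)

isoB-∸ : ∀ {N M y q} → All (_≤ N) y → All (_≤ M) q → isoB (map (N ∸_) y) (map (M ∸_) q) ≡ isoB y q
isoB-∸ {N} {M} {y} {q} y≤N q≤M rewrite length-map (N ∸_) y | length-map (M ∸_) q =
  cong ((length y ≡ᵇ length q) ∧_) (trans (cong sameCmpAll (zip-map (N ∸_) (M ∸_) y q))
    (sameCmpAll-map (Product.map (N ∸_) (M ∸_)) (zip-All y≤N q≤M)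
      (λ (y₁≤N , q₁≤M) (y₂≤N , q₂≤M) → sameCmp-∸ y₁≤N y₂≤N q₁≤M q₂≤M)))

letters≤maxLetter : ∀ p → All (_≤ maxLetter p) p
letters≤maxLetter []      = []
letters≤maxLetter (a ∷ p) = m≤m⊔n a _ ∷ All.map (λ b≤ → ≤-trans b≤ (m≤n⊔m a _)) (letters≤maxLetter p)

complement-involutive : ∀ p → map (suc (maxLetter p) ∸_) (complement p) ≡ p
complement-involutive p = trans (sym (map-∘ p))
  (map-id-local (All.map (λ a≤M → m∸[m∸n]≡n (m≤n⇒m≤1+n a≤M)) (letters≤maxLetter p)))

isoB-complement : ∀ {N y} p → All (_≤ N) y → isoB (map (N ∸_) y) p ≡ isoB y (complement p)
isoB-complement {N} {y} p y≤N = begin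
  isoB (map (N ∸_) y) p                            ≡⟨ cong (isoB (map (N ∸_) y)) (complement-involutive p) ⟨
  isoB (map (N ∸_) y) (map (M ∸_) (complement p))  ≡⟨ isoB-∸ y≤N (map⁺ (All.universal (λ a → m∸n≤m M a) p)) ⟩
  isoB y (complement p)                            ∎
  where M = suc (maxLetter p)

-- Occurrences of multi-patterns

data Occurs (p : List ℕ) (ps : List (List ℕ)) : List ℕ → Set where
  occurs : ∀ a b c → T (isoB b p) → T (containsB ps c) → Occurs p ps (a ++ b ++ c)

isoB⇒length≡ : ∀ y p → T (isoB y p) → length y ≡ length p
isoB⇒length≡ y p iso = ≡ᵇ⇒≡ (length y) (length p) (proj₁ (to T-∧ iso))

take-length-++ : ∀ {A : Set} (xs ys : List A) → take (length xs) (xs ++ ys) ≡ xs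
take-length-++ []       ys = refl
take-length-++ (x ∷ xs) ys = cong (x ∷_) (take-length-++ xs ys)

drop-length-++ : ∀ {A : Set} (xs ys : List A) → drop (length xs) (xs ++ ys) ≡ ys
drop-length-++ []       ys = refl
drop-length-++ (x ∷ xs) ys = drop-length-++ xs ys

occursThen-here : ∀ p ps u → T (isoB (take (length p) u) p) → T (containsB ps (drop (length p) u)) →
                  T (occursThen p ps u)
occursThen-here []      ps []      iso u∋ps = from T-∧ (iso , u∋ps)
occursThen-here (_ ∷ _) ps []      iso u∋ps = from T-∧ (iso , u∋ps)
occursThen-here p       ps (_ ∷ _) iso u∋ps = from T-∨ (inj₁ (from T-∧ (iso , u∋ps)))

occursThen-++ : ∀ p ps b c → T (isoB b p) → T (containsB ps c) → T (occursThen p ps (b ++ c))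
occursThen-++ p ps b c iso c∋ps = occursThen-here p ps (b ++ c) iso′ c∋ps′
  where
  |b|≡|p| : length b ≡ length p
  |b|≡|p| = isoB⇒length≡ b p iso
  iso′ : T (isoB (take (length p) (b ++ c)) p)
  iso′ = subst (λ n → T (isoB (take n (b ++ c)) p)) |b|≡|p|
               (subst (λ u → T (isoB u p)) (sym (take-length-++ b c)) iso)
  c∋ps′ : T (containsB ps (drop (length p) (b ++ c)))
  c∋ps′ = subst (λ n → T (containsB ps (drop n (b ++ c)))) |b|≡|p|
                (subst (T ∘ containsB ps) (sym (drop-length-++ b c)) c∋ps)

occursThen⇒Occurs : ∀ p ps w → T (occursThen p ps w) → Occurs p ps w
occursThen⇒Occurs p ps []      h = occurs [] [] [] (proj₁ (to T-∧ h)) (proj₂ (to T-∧ h))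
occursThen⇒Occurs p ps (x ∷ w) h with to T-∨ h
... | inj₁ here  = subst (Occurs p ps) (take++drop≡id (length p) (x ∷ w))
                         (occurs [] _ _ (proj₁ (to T-∧ here)) (proj₂ (to T-∧ here)))
... | inj₂ there with occursThen⇒Occurs p ps w there
...   | occurs a b c iso c∋ps = occurs (x ∷ a) b c iso c∋ps

Occurs⇒occursThen : ∀ {p ps w} → Occurs p ps w → T (occursThen p ps w)
Occurs⇒occursThen {p} {ps} (occurs []      b c iso c∋ps) = occursThen-++ p ps b c iso c∋ps
Occurs⇒occursThen          (occurs (x ∷ a) b c iso c∋ps) = from T-∨ (inj₂ (Occurs⇒occursThen (occurs a b c iso c∋ps)))

Occurs-extend : ∀ {p ps qs u} v → Occurs p ps u → (∀ {c} → T (containsB ps c) → T (containsB qs (c ++ v))) →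
                Occurs p qs (u ++ v)
Occurs-extend v (occurs a b c iso c∋ps) extend =
  subst (Occurs _ _) (sym (trans (++-assoc a (b ++ c) v) (cong (a ++_) (++-assoc b c v))))
        (occurs a b (c ++ v) iso (extend c∋ps))

containsB-++⁺ˡ : ∀ ps {u} v → T (containsB ps u) → T (containsB ps (u ++ v))
containsB-++⁺ˡ []       v _    = _
containsB-++⁺ˡ (p ∷ ps) {u} v u∋ps =
  Occurs⇒occursThen (Occurs-extend {qs = ps} v (occursThen⇒Occurs p ps u u∋ps) (containsB-++⁺ˡ ps v))

containsB-++⁺ʳ : ∀ ps u {v} → T (containsB ps v) → T (containsB ps (u ++ v))
containsB-++⁺ʳ []       u       _    = _
containsB-++⁺ʳ (p ∷ ps) []      v∋ps = v∋ps
containsB-++⁺ʳ (p ∷ ps) (x ∷ u) v∋ps = from T-∨ (inj₂ (containsB-++⁺ʳ (p ∷ ps) u v∋ps))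

containsB-∷-++ : ∀ p ps {u v} → T (containsB [ p ] u) → T (containsB ps v) → T (containsB (p ∷ ps) (u ++ v))
containsB-∷-++ p ps {u} {v} u∋p v∋ps =
  Occurs⇒occursThen (Occurs-extend {qs = ps} v (occursThen⇒Occurs p [] u u∋p) (λ {c} _ → containsB-++⁺ʳ ps c v∋ps))

containsB-take : ∀ ps m u → T (containsB ps (take m u)) → T (containsB ps u)
containsB-take ps m u h = subst (T ∘ containsB ps) (take++drop≡id m u) (containsB-++⁺ˡ ps _ h)

containsB-drop-suc : ∀ ps m w → T (containsB ps (drop (suc m) w)) → T (containsB ps (drop m w))
containsB-drop-suc ps m w h =
  subst (T ∘ containsB ps) (take++drop≡id 1 (drop m w)) (containsB-++⁺ʳ ps _ (subst (T ∘ containsB ps) drop-suc h))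
  where
  drop-suc : drop (suc m) w ≡ drop 1 (drop m w)
  drop-suc = trans (cong (λ j → drop j w) (+-comm 1 m)) (sym (drop-drop m 1 w))

-- Trivial bijections on a single block

containsB-reverse : ∀ p w → T (containsB [ p ] w) → T (containsB [ reverse p ] (reverse w))
containsB-reverse p w w∋p with occursThen⇒Occurs p [] w w∋p
... | occurs a b c iso _ = subst (T ∘ containsB [ reverse p ]) (sym reverse-abc)
  (Occurs⇒occursThen (occurs (reverse c) (reverse b) (reverse a) (subst T (sym (isoB-reverse b p)) iso) _))
  where
  reverse-abc : reverse (a ++ b ++ c) ≡ reverse c ++ reverse b ++ reverse a
  reverse-abc = begin
    reverse (a ++ b ++ c)                ≡⟨ reverse-++ a (b ++ c) ⟩
    reverse (b ++ c) ++ reverse a        ≡⟨ cong (_++ reverse a) (reverse-++ b c) ⟩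
    (reverse c ++ reverse b) ++ reverse a ≡⟨ ++-assoc (reverse c) (reverse b) (reverse a) ⟩
    reverse c ++ reverse b ++ reverse a  ∎

containsB-reverse≡ : ∀ p w → containsB [ reverse p ] w ≡ containsB [ p ] (reverse w)
containsB-reverse≡ p w = bool-ext
  (λ w∋p′ → subst (λ q → T (containsB [ q ] (reverse w))) (reverse-involutive p) (containsB-reverse (reverse p) w w∋p′))
  (λ w′∋p → subst (T ∘ containsB [ reverse p ]) (reverse-involutive w) (containsB-reverse p (reverse w) w′∋p))

containsB-complement≡ : ∀ N p w → All (_≤ N) w → containsB [ complement p ] w ≡ containsB [ p ] (map (N ∸_) w)
containsB-complement≡ N p []      []           = cong (_∧ true) (sym (isoB-complement {N} p []))
containsB-complement≡ N p (x ∷ w) (x≤N ∷ w≤N) =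
  cong₂ _∨_ (cong (_∧ true) prefix) (containsB-complement≡ N p w w≤N)
  where
  prefix : isoB (take (length (complement p)) (x ∷ w)) (complement p) ≡ isoB (take (length p) (map (N ∸_) (x ∷ w))) p
  prefix = begin
    isoB (take (length (complement p)) (x ∷ w)) (complement p)
      ≡⟨ cong (λ n → isoB (take n (x ∷ w)) (complement p)) (length-map _ p) ⟩
    isoB (take (length p) (x ∷ w)) (complement p)
      ≡⟨ isoB-complement p (take⁺ (length p) (x≤N ∷ w≤N)) ⟨
    isoB (map (N ∸_) (take (length p) (x ∷ w))) p
      ≡⟨ cong (λ u → isoB u p) (take-map (length p) (x ∷ w)) ⟨
    isoB (take (length p) (map (N ∸_) (x ∷ w))) p ∎

EquiContained : ℕ → List (List ℕ) → List (List ℕ) → Set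
EquiContained k τ σ = ∀ n → count k n (containsB τ) ≡ count k n (containsB σ)

module _ (k : ℕ) where

  EquiContained-reverse : ∀ p → EquiContained k [ p ] [ reverse p ]
  EquiContained-reverse p n = begin
    count k n (containsB [ p ])            ≡⟨ count-reverse k n (containsB [ p ]) ⟨
    count k n (containsB [ p ] ∘ reverse)  ≡⟨ count-cong k n (containsB-reverse≡ p) ⟨
    count k n (containsB [ reverse p ])    ∎

  EquiContained-complement : ∀ p → EquiContained k [ p ] [ complement p ]
  EquiContained-complement p n = begin
    count k n (containsB [ p ])
      ≡⟨ count-complement k n (containsB [ p ]) ⟨
    count k n (containsB [ p ] ∘ map (suc k ∸_))
      ≡⟨ count-congʷ k n (λ w _ w≤k → sym (containsB-complement≡ (suc k) p w (All.map m≤n⇒m≤1+n w≤k))) ⟩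
    count k n (containsB [ complement p ]) ∎

  EquiContained-applyTB : ∀ t p → EquiContained k [ p ] [ applyTB t p ]
  EquiContained-applyTB R  p   = EquiContained-reverse p
  EquiContained-applyTB C  p   = EquiContained-complement p
  EquiContained-applyTB RC p n = trans (EquiContained-complement p n) (EquiContained-reverse (complement p) n)

-- Splitting a word at the shortest prefix containing the first block

newlyContains : List (List ℕ) → ℕ → List ℕ → Bool
newlyContains τ m u = containsB τ u ∧ not (containsB τ (take m u))

take-take-suc : ∀ {A : Set} m (w : List A) → take m (take (suc m) w) ≡ take m w
take-take-suc m w = trans (take-take m (suc m) w) (cong (λ j → take j w) (m≤n⇒m⊓n≡m (n≤1+n m)))

module Decomposition (p : List ℕ) (ps : List (List ℕ)) where

  splitsAt : ℕ → List ℕ → Bool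
  splitsAt j w = containsB [ p ] (take j w) ∧ containsB ps (drop j w)

  splitsFirstAt : ℕ → List ℕ → Bool
  splitsFirstAt m w = newlyContains [ p ] m (take (suc m) w) ∧ containsB ps (drop (suc m) w)

  -- splitsBy m w says that splitsAt j w for some j ≤ m, written as a disjoint union
  -- over the length of the shortest prefix of w containing p.
  splitsBy : ℕ → List ℕ → Bool
  splitsBy zero    w = splitsAt 0 w
  splitsBy (suc m) w = splitsBy m w ∨ splitsFirstAt m w

  splitsFirstAt⁻ : ∀ m w → T (splitsFirstAt m w) →
                   T (containsB [ p ] (take (suc m) w)) × ¬ T (containsB [ p ] (take m w)) × T (containsB ps (drop (suc m) w))
  splitsFirstAt⁻ m w h =
    let newly , rest∋ps = to (T-∧ {newlyContains [ p ] m (take (suc m) w)}) h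
        prefix∋p , shorter∌p = to (T-∧ {containsB [ p ] (take (suc m) w)}) newly
    in prefix∋p , T-not⇒¬T (subst (T ∘ not ∘ containsB [ p ]) (take-take-suc m w) shorter∌p) , rest∋ps

  splitsFirstAt⁺ : ∀ m w → T (containsB [ p ] (take (suc m) w)) → ¬ T (containsB [ p ] (take m w)) →
                   T (containsB ps (drop (suc m) w)) → T (splitsFirstAt m w)
  splitsFirstAt⁺ m w prefix∋p shorter∌p rest∋ps = from T-∧ (from T-∧ (prefix∋p , shorter∌p′) , rest∋ps)
    where
    shorter∌p′ : T (not (containsB [ p ] (take m (take (suc m) w))))
    shorter∌p′ = subst (T ∘ not ∘ containsB [ p ]) (sym (take-take-suc m w)) (¬T⇒T-not shorter∌p)

  splitsBy⇒prefix∋p : ∀ m w → T (splitsBy m w) → T (containsB [ p ] (take m w))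
  splitsBy⇒prefix∋p zero    w h = proj₁ (to T-∧ h)
  splitsBy⇒prefix∋p (suc m) w h with to (T-∨ {splitsBy m w}) h
  ... | inj₁ h′ = containsB-take [ p ] m (take (suc m) w)
                    (subst (T ∘ containsB [ p ]) (sym (take-take-suc m w)) (splitsBy⇒prefix∋p m w h′))
  ... | inj₂ h′ = proj₁ (splitsFirstAt⁻ m w h′)

  splitsBy-disjoint : ∀ m w → T (splitsBy m w) → ¬ T (splitsFirstAt m w)
  splitsBy-disjoint m w h h′ = proj₁ (proj₂ (splitsFirstAt⁻ m w h′)) (splitsBy⇒prefix∋p m w h)

  splitsBy⇒splitsAt : ∀ m w → T (splitsBy m w) → ∃[ j ] T (splitsAt j w)
  splitsBy⇒splitsAt zero    w h = 0 , h
  splitsBy⇒splitsAt (suc m) w h with to (T-∨ {splitsBy m w}) h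
  ... | inj₁ h′ = splitsBy⇒splitsAt m w h′
  ... | inj₂ h′ = let prefix∋p , _ , rest∋ps = splitsFirstAt⁻ m w h′ in suc m , from T-∧ (prefix∋p , rest∋ps)

  splitsAt⇒splitsBy : ∀ {j} m w → j ≤ m → T (splitsAt j w) → T (splitsBy m w)
  splitsAt⇒splitsBy zero    w z≤n h = h
  splitsAt⇒splitsBy (suc m) w j≤1+m h with m≤n⇒m<n∨m≡n j≤1+m
  ... | inj₁ (s≤s j≤m) = from (T-∨ {splitsBy m w}) (inj₁ (splitsAt⇒splitsBy m w j≤m h))
  ... | inj₂ refl with to (T-∧ {containsB [ p ] (take (suc m) w)}) h | T? (containsB [ p ] (take m w))
  -- If the prefix of length m already contains p, split one letter earlier: the suffix only grows.
  ...   | _        , rest∋ps | yes shorter∋p = from (T-∨ {splitsBy m w})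
    (inj₁ (splitsAt⇒splitsBy m w ≤-refl (from T-∧ (shorter∋p , containsB-drop-suc ps m w rest∋ps))))
  ...   | prefix∋p , rest∋ps | no  shorter∌p = from (T-∨ {splitsBy m w})
    (inj₂ (splitsFirstAt⁺ m w prefix∋p shorter∌p rest∋ps))

  splitsAt⇒containsB : ∀ j w → T (splitsAt j w) → T (containsB (p ∷ ps) w)
  splitsAt⇒containsB j w h = subst (T ∘ containsB (p ∷ ps)) (take++drop≡id j w)
    (containsB-∷-++ p ps {take j w} {drop j w} (proj₁ (to T-∧ h)) (proj₂ (to T-∧ h)))

  containsB⇒splitsAt : ∀ w → T (containsB (p ∷ ps) w) → ∃[ j ] j ≤ length w × T (splitsAt j w)
  containsB⇒splitsAt w h with occursThen⇒Occurs p ps w h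
  ... | occurs a b c iso c∋ps rewrite sym (++-assoc a b c) =
    length (a ++ b) , length-++-≤ˡ (a ++ b) , from T-∧ (ab∋p , c∋ps′)
    where
    ab∋p : T (containsB [ p ] (take (length (a ++ b)) ((a ++ b) ++ c)))
    ab∋p = subst (T ∘ containsB [ p ]) (trans (sym (++-assoc a b [])) (trans (++-identityʳ (a ++ b))
                   (sym (take-length-++ (a ++ b) c))))
             (Occurs⇒occursThen (occurs a b [] iso _))
    c∋ps′ : T (containsB ps (drop (length (a ++ b)) ((a ++ b) ++ c)))
    c∋ps′ = subst (T ∘ containsB ps) (sym (drop-length-++ (a ++ b) c)) c∋ps

  containsB≡splitsBy : ∀ w → containsB (p ∷ ps) w ≡ splitsBy (length w) w
  containsB≡splitsBy w = bool-ext
    (λ h → let j , j≤|w| , split = containsB⇒splitsAt w h in splitsAt⇒splitsBy (length w) w j≤|w| split)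
    (λ h → let j , split = splitsBy⇒splitsAt (length w) w h in splitsAt⇒containsB j w split)

open Decomposition

module _ (k : ℕ) where

  count-take : ∀ m P → count k (suc m) (P ∘ take m) ≡ count k m P * count k 1 (λ _ → true)
  count-take m P = begin
    count k (suc m) (P ∘ take m)                  ≡⟨ cong (λ n → count k n (P ∘ take m)) (+-comm 1 m) ⟩
    count k (m + 1) (P ∘ take m)                  ≡⟨ count-cong k (m + 1) (λ w → sym (∧-identityʳ (P (take m w)))) ⟩
    count k (m + 1) (λ w → P (take m w) ∧ true)   ≡⟨ count-∧-split k m 1 P (λ _ → true) ⟩
    count k m P * count k 1 (λ _ → true)          ∎

  count-newlyContains : ∀ τ m → count k (suc m) (containsB τ) ≡
                                count k (suc m) (newlyContains τ m) + count k m (containsB τ) * count k 1 (λ _ → true)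
  count-newlyContains τ m = begin
    count k (suc m) (containsB τ)
      ≡⟨ count-cong k (suc m) (λ u → split-by-implied _ _ (containsB-take τ m u)) ⟩
    count k (suc m) (λ u → newlyContains τ m u ∨ containsB τ (take m u))
      ≡⟨ count-∨ k (suc m) {newlyContains τ m} {containsB τ ∘ take m} (λ u new → T-not⇒¬T (proj₂ (to (T-∧ {containsB τ u}) new))) ⟩
    count k (suc m) (newlyContains τ m) + count k (suc m) (containsB τ ∘ take m)
      ≡⟨ cong (count k (suc m) (newlyContains τ m) +_) (count-take m (containsB τ)) ⟩
    count k (suc m) (newlyContains τ m) + count k m (containsB τ) * count k 1 (λ _ → true) ∎

  count-∧-split-cong : ∀ m n P P′ Q Q′ → count k m P ≡ count k m P′ → count k n Q ≡ count k n Q′ →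
    count k (m + n) (λ w → P (take m w) ∧ Q (drop m w)) ≡ count k (m + n) (λ w → P′ (take m w) ∧ Q′ (drop m w))
  count-∧-split-cong m n P P′ Q Q′ P≡P′ Q≡Q′ =
    trans (count-∧-split k m n P Q) (trans (cong₂ _*_ P≡P′ Q≡Q′) (sym (count-∧-split k m n P′ Q′)))

  count-containsB-∷ : ∀ p ps n → count k n (containsB (p ∷ ps)) ≡ count k n (splitsBy p ps n)
  count-containsB-∷ p ps n = count-congʷ k n λ w |w|≡n _ →
    trans (containsB≡splitsBy p ps w) (cong (λ m → splitsBy p ps m w) |w|≡n)

  module _ {p q ps qs} (p≈q : EquiContained k [ p ] [ q ]) (ps≈qs : EquiContained k ps qs) where

    count-newlyContains-cong : ∀ m → count k (suc m) (newlyContains [ p ] m) ≡ count k (suc m) (newlyContains [ q ] m)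
    count-newlyContains-cong m = +-cancelʳ-≡ (count k m (containsB [ p ]) * c₁) _ _ (begin
      count k (suc m) (newlyContains [ p ] m) + count k m (containsB [ p ]) * c₁  ≡⟨ count-newlyContains [ p ] m ⟨
      count k (suc m) (containsB [ p ])                                          ≡⟨ p≈q (suc m) ⟩
      count k (suc m) (containsB [ q ])                                          ≡⟨ count-newlyContains [ q ] m ⟩
      count k (suc m) (newlyContains [ q ] m) + count k m (containsB [ q ]) * c₁  ≡⟨ cong (λ x → _ + x * c₁) (p≈q m) ⟨
      count k (suc m) (newlyContains [ q ] m) + count k m (containsB [ p ]) * c₁  ∎)
      where c₁ = count k 1 (λ _ → true)

    count-splitsBy-cong : ∀ m d → count k (m + d) (splitsBy p ps m) ≡ count k (m + d) (splitsBy q qs m)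
    count-splitsBy-cong zero    d =
      count-∧-split-cong 0 d (containsB [ p ]) (containsB [ q ]) (containsB ps) (containsB qs) (p≈q 0) (ps≈qs d)
    count-splitsBy-cong (suc m) d = begin
      count k (suc m + d) (splitsBy p ps (suc m))
        ≡⟨ count-∨ k (suc m + d) (splitsBy-disjoint p ps m) ⟩
      count k (suc m + d) (splitsBy p ps m) + count k (suc m + d) (splitsFirstAt p ps m)
        ≡⟨ cong₂ _+_ shorter first ⟩
      count k (suc m + d) (splitsBy q qs m) + count k (suc m + d) (splitsFirstAt q qs m)
        ≡⟨ count-∨ k (suc m + d) (splitsBy-disjoint q qs m) ⟨
      count k (suc m + d) (splitsBy q qs (suc m)) ∎
      where
      shorter : count k (suc m + d) (splitsBy p ps m) ≡ count k (suc m + d) (splitsBy q qs m)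
      shorter = subst (λ n → count k n (splitsBy p ps m) ≡ count k n (splitsBy q qs m)) (+-suc m d)
                      (count-splitsBy-cong m (suc d))
      first : count k (suc m + d) (splitsFirstAt p ps m) ≡ count k (suc m + d) (splitsFirstAt q qs m)
      first = count-∧-split-cong (suc m) d (newlyContains [ p ] m) (newlyContains [ q ] m) (containsB ps) (containsB qs)
                                 (count-newlyContains-cong m) (ps≈qs d)

    EquiContained-∷ : EquiContained k (p ∷ ps) (q ∷ qs)
    EquiContained-∷ n = begin
      count k n (containsB (p ∷ ps))  ≡⟨ count-containsB-∷ p ps n ⟩
      count k n (splitsBy p ps n)     ≡⟨ subst (λ l → count k l (splitsBy p ps n) ≡ count k l (splitsBy q qs n))
                                               (+-identityʳ n) (count-splitsBy-cong n 0) ⟩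
      count k n (splitsBy q qs n)     ≡⟨ count-containsB-∷ q qs n ⟨
      count k n (containsB (q ∷ qs))  ∎

  EquiContained-pointwise : ∀ {τ σ} → Pointwise (λ p q → EquiContained k [ p ] [ q ]) τ σ → EquiContained k τ σ
  EquiContained-pointwise []            n = refl
  EquiContained-pointwise (p≈q ∷ τ≈σ) = EquiContained-∷ p≈q (EquiContained-pointwise τ≈σ)

  avoidCount-cong : ∀ {τ σ} → EquiContained k τ σ → ∀ n → avoidCount τ k n ≡ avoidCount σ k n
  avoidCount-cong {τ} {σ} τ≈σ n = begin
    avoidCount τ k n                 ≡⟨ length-filterᵇ-allWords k n _ ⟩
    count k n (not ∘ containsB τ)    ≡⟨ count-not-cong k n (τ≈σ n) ⟩
    count k n (not ∘ containsB σ)    ≡⟨ length-filterᵇ-allWords k n _ ⟨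
    avoidCount σ k n                 ∎

-- The blocks need not be generalized patterns: each block is complemented within its own
-- largest letter, so complementation reverses the order among its letters in any case.
mainTheorem9 : (s : ℕ) (τ : Fin (suc s) → List ℕ) → ((i : Fin (suc s)) → IsGenPattern (τ i))
    → (f : Fin (suc s) → TrivBij)
    → toList τ ≡ₚ toList (λ i → applyTB (f i) (τ i))
mainTheorem9 s τ _ f k =
  avoidCount-cong k (EquiContained-pointwise k (tabulate⁺ λ i → EquiContained-applyTB k (f i) (τ i)))
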